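{- Let $m$ be a positive integer and let $n\geq \ell(m)$ be an integer. Then the graph $R(n,\ell(m);m)=L(\ell(m),m)\cup E_{n-\ell(m)}$ on $n$ vertices and $m$ edges is $J$-extremal.
   Context: $J$ is the graph (with loops) on three vertices $a,b,c$ whose edges are $ab$ and a loop at $b$; $c$ is an isolated unlooped vertex. For a simple graph $G$, $j(G)$ denotes the number of maps $\phi:V(G)\to V(J)$ with $\phi(x)\phi(y)\in E(J)$ whenever $xy\in E(G)$. A graph with $n$ vertices and $m$ edges is $J$-extremal if $j(G)\geq j(G')$ for every simple graph $G'$ with $n$ vertices and $m$ edges. The lexicographic order on subsets of $[q]$ is $A<B$ iff $\min(A\triangle B)\in A$; the lex graph $L(q,m)$ has vertex set $[q]$ and edge set the first $m$ two-element subsets of $[q]$ in this order. $E_r$ is the edgeless graph on $r$ vertices. For integers $n,q,m$ with $q\le\min\{n,m+1\}$ and $0\le m\le\binom q2$, $R(n,q;m)=L(q,m)\cup E_{n-q}$ (disjoint union). Finally, $\ell(m)=\max\{q : R(m+1,q;m)\text{ is }J\text{ -extremal}\}$, the maximum over admissible $q$. -}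

module Defs where

open import Data.Bool using (Bool; true; false; _∧_; _∨_; not; if_then_else_; _xor_)
open import Data.Nat using (ℕ; zero; suc; _+_; _≤_; _<ᵇ_; _≡ᵇ_)
open import Data.Nat.Combinatorics using (_C_)
open import Data.Fin using (Fin; toℕ)
open import Data.Vec using (Vec; []; _∷_; lookup; tabulate)
open import Data.List using (List; []; _∷_; map; concatMap; allFin; upTo; filterᵇ; length)
open import Data.Nat.ListAction using (sum)
open import Data.Bool.ListAction using (and)
open import Data.Product using (_×_; _,_)
open import Relation.Binary.PropositionalEquality using (_≡_)

Graph : ℕ → Set
Graph n = Fin n → Fin n → Bool

Simple : ∀ {n} → Graph n → Set
Simple {n} G = (∀ (x y : Fin n) → G x y ≡ G y x) × (∀ (x : Fin n) → G x x ≡ false)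

edgeCount : ∀ {n} → Graph n → ℕ
edgeCount {n} G =
  sum (concatMap (λ x → map (λ y → if (toℕ x <ᵇ toℕ y) ∧ G x y then 1 else 0) (allFin n)) (allFin n))

-- The target graph J on vertices a = 0, b = 1, c = 2: edge ab and a loop at b.
jAdj : Fin 3 → Fin 3 → Bool
jAdj Fin.zero (Fin.suc Fin.zero) = true
jAdj (Fin.suc Fin.zero) Fin.zero = true
jAdj (Fin.suc Fin.zero) (Fin.suc Fin.zero) = true
jAdj _ _ = false

allMaps : ∀ n → List (Vec (Fin 3) n)
allMaps zero = [] ∷ []
allMaps (suc n) = concatMap (λ c → map (c ∷_) (allMaps n)) (allFin 3)

isHom : ∀ {n} → Graph n → Vec (Fin 3) n → Bool
isHom {n} G φ =
  and (concatMap (λ x → map (λ y → not (G x y) ∨ jAdj (lookup φ x) (lookup φ y)) (allFin n)) (allFin n))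

jHom : ∀ {n} → Graph n → ℕ
jHom {n} G = length (filterᵇ (isHom G) (allMaps n))

IsJExtremal : (n m : ℕ) → Graph n → Set
IsJExtremal n m G =
  Simple G × edgeCount G ≡ m ×
  (∀ (G' : Graph n) → Simple G' → edgeCount G' ≡ m → jHom G' Data.Nat.≤ jHom G)

-- lexicographic order on subsets of [q] given as characteristic vectors:
-- A < B iff min(A △ B) ∈ A
lexLt : ∀ {q} → Vec Bool q → Vec Bool q → Bool
lexLt [] [] = false
lexLt (a ∷ as) (b ∷ bs) = if a xor b then a else lexLt as bs

pairVec : (q a b : ℕ) → Vec Bool q
pairVec q a b = tabulate (λ k → (toℕ k ≡ᵇ a) ∨ (toℕ k ≡ᵇ b))

twoSubsets : ℕ → List (ℕ × ℕ)
twoSubsets q = concatMap (λ l → map (λ k → (k , l)) (upTo l)) (upTo q)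

lexRank : (q a b : ℕ) → ℕ
lexRank q a b =
  length (filterᵇ (λ p → lexLt (pairVec q (Data.Product.proj₁ p) (Data.Product.proj₂ p)) (pairVec q a b))
                  (twoSubsets q))

-- R(n, q; m) = L(q, m) ∪ E_{n-q}: vertices 0..q-1 carry the lex graph L(q,m)
-- (the first m two-subsets of [q] in lex order), vertices q..n-1 are isolated.
R : (n q m : ℕ) → Graph n
R n q m x y =
  (toℕ x <ᵇ q) ∧ (toℕ y <ᵇ q) ∧ not (toℕ x ≡ᵇ toℕ y) ∧ (lexRank q (toℕ x) (toℕ y) <ᵇ m)

Admissible : (n q m : ℕ) → Set
Admissible n q m = q ≤ n × q ≤ suc m × m ≤ q C 2

IsEll : (m q : ℕ) → Set
IsEll m q =
  Admissible (suc m) q m × IsJExtremal (suc m) m (R (suc m) q m) ×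
  (∀ q' → Admissible (suc m) q' m → IsJExtremal (suc m) m (R (suc m) q' m) → q' ≤ q)

-- Write M(n) for "R(n, q; m) maximises j among simple graphs with n vertices and m edges";
-- M(m + 1) is part of the hypothesis q = ℓ(m), and we spread it in both directions.
-- Adding an isolated vertex multiplies j by 3, and for q ≤ n the last vertex of R(n + 1, q; m)
-- is isolated, so M(n + 1) implies M(n). Conversely, for n > m a graph G on n + 1 vertices with
-- m edges has a vertex v of degree at most one. If v is isolated, j(G) = 3 j(G - v). If v is a
-- leaf with neighbour u, then H = G - v has too few edges for u to be adjacent to everything, so
-- there is a w with uw ∉ E(H), and j(G) ≤ 3 j(H + uw): a colouring of H extends to v in 1, 2 or
-- 0 ways according as u is coloured a, b or c, and summing over the colour of w, which is
-- either irrelevant (w isolated in H) or never c and better b than a, gives the bound. In both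
-- cases j(G) ≤ 3 j(R(n, q; m)) = j(R(n + 1, q; m)), so M(n) implies M(n + 1).

module Submission where

open import Defs
open import Data.Nat using (ℕ; zero; suc; _+_; _*_; _≤_; _<_; _≤′_; ≤′-reflexive; ≤′-step; _≤‴_; ≤‴-reflexive; ≤‴-step;
                            _<ᵇ_; _≡ᵇ_; _≤?_; z≤n; s≤s)
open import Data.Nat.Properties
open import Data.Nat.Tactic.RingSolver using (solve-∀)
open import Data.Nat.ListAction using (sum)
open import Data.Bool as Bool using (Bool; true; false; T; _∧_; _∨_; not; if_then_else_)
open import Data.Bool.Properties using (∧-isMonoid; ∧-assoc; ∧-comm; ∧-zeroʳ; ∨-comm; ∨-zeroʳ; ¬-not)
open import Data.Fin using (Fin; zero; suc; toℕ; fromℕ; punchIn; punchOut)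
import Data.Fin.Properties as Fin
open import Data.Vec using (Vec; []; _∷_; lookup; insertAt)
open import Data.Vec.Properties using (insertAt-lookup; insertAt-punchIn; tabulate-cong)
import Data.Vec.Functional as Vector
open import Data.List as List using (List; []; _∷_; _++_; map; concatMap; allFin; filterᵇ; length)
import Data.List.Properties as List
open import Data.Product using (_×_; _,_; proj₁; proj₂; ∃)
open import Data.Sum using (_⊎_; inj₁; inj₂)
open import Algebra.Core using (Op₂)
open import Algebra.Structures using (IsMonoid)
open import Algebra.Properties.CommutativeMonoid.Sum +-0-commutativeMonoid
  using (sum-syntax; sum-cong-≗; ∑-comm; ∑-distrib-+; sum-remove) renaming (sum to ∑)
open import Algebra.Properties.Semiring.Sum +-*-semiring using (*-distribˡ-sum; *-distribʳ-sum)
open import Function using (_∘_; case_of_)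
open import Relation.Nullary using (yes; no; ¬_; does; contradiction)
open import Relation.Nullary.Decidable using (dec-true; dec-false)
open import Relation.Binary.PropositionalEquality

𝟙 : Bool → ℕ
𝟙 b = if b then 1 else 0

𝟙-mono : ∀ {a b : Bool} → (a ≡ true → b ≡ true) → 𝟙 a ≤ 𝟙 b
𝟙-mono {false} a⇒b = z≤n
𝟙-mono {true} a⇒b rewrite a⇒b refl = ≤-refl

𝟙-∧ : ∀ a b → 𝟙 (a ∧ b) ≡ 𝟙 a * 𝟙 b
𝟙-∧ false b = refl
𝟙-∧ true b = sym (+-identityʳ (𝟙 b))

∧-true⁻ : ∀ {a b : Bool} → a ∧ b ≡ true → a ≡ true × b ≡ true
∧-true⁻ {true} b≡true = refl , b≡true

∧-true⁺ : ∀ {a b : Bool} → a ≡ true → b ≡ true → a ∧ b ≡ true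
∧-true⁺ refl refl = refl

∨-true⁻ : ∀ {a b : Bool} → a ∨ b ≡ true → a ≡ true ⊎ b ≡ true
∨-true⁻ {true}  _ = inj₁ refl
∨-true⁻ {false} e = inj₂ e

∑-const : ∀ n k → ∑[ i < n ] k ≡ n * k
∑-const zero    k = refl
∑-const (suc n) k = cong (k +_) (∑-const n k)

sum-mono-≤ : ∀ {k} {f g : Fin k → ℕ} → (∀ i → f i ≤ g i) → ∑ f ≤ ∑ g
sum-mono-≤ {zero} f≤g = z≤n
sum-mono-≤ {suc k} f≤g = +-mono-≤ (f≤g zero) (sum-mono-≤ (f≤g ∘ suc))

∑-𝟙≡0 : ∀ {n} (f : Fin n → Bool) → ∑[ i < n ] 𝟙 (f i) ≡ 0 → ∀ i → f i ≡ false
∑-𝟙≡0 {suc n} f ∑≡0 i = 𝟙≡0 (m+n≡0⇒m≡0 (𝟙 (f i)) (trans (sym (sum-remove {i = i} (𝟙 ∘ f))) ∑≡0))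
  where
  𝟙≡0 : ∀ {b} → 𝟙 b ≡ 0 → b ≡ false
  𝟙≡0 {false} _ = refl

∑-𝟙≡1 : ∀ {n} (f : Fin n → Bool) → ∑[ i < n ] 𝟙 (f i) ≡ 1 → ∃ λ u → f u ≡ true × (∀ t → f t ≡ true → t ≡ u)
∑-𝟙≡1 {suc n} f ∑≡1 with f zero in f0
... | true  = zero , f0 , only-zero
  where
  only-zero : ∀ t → f t ≡ true → t ≡ zero
  only-zero zero    _   = refl
  only-zero (suc t) ft = contradiction (trans (sym ft) (∑-𝟙≡0 (f ∘ suc) (suc-injective ∑≡1) t)) λ ()
... | false = let (u , fu , only-u) = ∑-𝟙≡1 (f ∘ suc) ∑≡1 in suc u , fu , only-suc only-u
  where
  only-suc : ∀ {u} → (∀ t → f (suc t) ≡ true → t ≡ u) → ∀ t → f t ≡ true → t ≡ suc u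
  only-suc only-u zero    f0≡true = contradiction (trans (sym f0) f0≡true) λ ()
  only-suc only-u (suc t) ft      = cong suc (only-u t ft)

∑-𝟙-≟ : ∀ {n} (t : Fin n) → ∑[ y < n ] 𝟙 (does (y Fin.≟ t)) ≡ 1
∑-𝟙-≟ {suc n} t = trans (sum-remove {i = t} (λ y → 𝟙 (does (y Fin.≟ t))))
  (cong₂ _+_ (cong 𝟙 (dec-true (t Fin.≟ t) refl))
             (trans (sum-cong-≗ λ y → cong 𝟙 (dec-false (punchIn t y Fin.≟ t) (Fin.punchInᵢ≢i t y)))
                    (trans (∑-const n 0) (*-zeroʳ n))))

module ListFold {A : Set} {_∙_ : Op₂ A} {ε : A} (isMonoid : IsMonoid _≡_ _∙_ ε) where
  open IsMonoid isMonoid using (assoc; identityˡ)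

  fold : List A → A
  fold = List.foldr _∙_ ε

  fold-++ : ∀ xs ys → fold (xs ++ ys) ≡ fold xs ∙ fold ys
  fold-++ [] ys = sym (identityˡ (fold ys))
  fold-++ (x ∷ xs) ys = trans (cong (x ∙_) (fold-++ xs ys)) (sym (assoc x (fold xs) (fold ys)))

  fold-concatMap : ∀ {B : Set} (f : B → List A) xs → fold (concatMap f xs) ≡ fold (map (fold ∘ f) xs)
  fold-concatMap f [] = refl
  fold-concatMap f (x ∷ xs) = trans (fold-++ (f x) (concatMap f xs)) (cong (fold (f x) ∙_) (fold-concatMap f xs))

  fold-tabulate : ∀ n (f : Fin n → A) → fold (List.tabulate f) ≡ Vector.foldr _∙_ ε f
  fold-tabulate zero f = refl
  fold-tabulate (suc n) f = cong (f zero ∙_) (fold-tabulate n (f ∘ suc))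

  fold-map-allFin : ∀ n (f : Fin n → A) → fold (map f (allFin n)) ≡ Vector.foldr _∙_ ε f
  fold-map-allFin n f = trans (cong fold (List.map-tabulate (λ i → i) f)) (fold-tabulate n f)

open ListFold +-0-isMonoid using () renaming (fold-concatMap to sum-concatMap; fold-map-allFin to sum-map-allFin)
open ListFold ∧-isMonoid using () renaming (fold-concatMap to and-concatMap; fold-map-allFin to and-map-allFin)

all-true⁻ : ∀ {n} (f : Fin n → Bool) → Vector.foldr _∧_ true f ≡ true → ∀ i → f i ≡ true
all-true⁻ {suc n} f all-f i with f zero in f0
all-true⁻ {suc n} f all-f zero    | true = f0
all-true⁻ {suc n} f all-f (suc i) | true = all-true⁻ (f ∘ suc) all-f i

all-true⁺ : ∀ {n} (f : Fin n → Bool) → (∀ i → f i ≡ true) → Vector.foldr _∧_ true f ≡ true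
all-true⁺ {zero} f f≡true = refl
all-true⁺ {suc n} f f≡true rewrite f≡true zero = all-true⁺ (f ∘ suc) (f≡true ∘ suc)

∑maps : ∀ n → (Vec (Fin 3) n → ℕ) → ℕ
∑maps zero h = h []
∑maps (suc n) h = ∑[ c < 3 ] ∑maps n (λ ψ → h (c ∷ ψ))

∑maps-cong : ∀ n {f g : Vec (Fin 3) n → ℕ} → (∀ ψ → f ψ ≡ g ψ) → ∑maps n f ≡ ∑maps n g
∑maps-cong zero f≗g = f≗g []
∑maps-cong (suc n) f≗g = sum-cong-≗ (λ c → ∑maps-cong n (λ ψ → f≗g (c ∷ ψ)))

∑maps-mono-≤ : ∀ n {f g : Vec (Fin 3) n → ℕ} → (∀ ψ → f ψ ≤ g ψ) → ∑maps n f ≤ ∑maps n g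
∑maps-mono-≤ zero f≤g = f≤g []
∑maps-mono-≤ (suc n) f≤g = sum-mono-≤ (λ c → ∑maps-mono-≤ n (λ ψ → f≤g (c ∷ ψ)))

∑maps-*ˡ : ∀ n a (f : Vec (Fin 3) n → ℕ) → ∑maps n (λ ψ → a * f ψ) ≡ a * ∑maps n f
∑maps-*ˡ zero a f = refl
∑maps-*ˡ (suc n) a f = trans (sum-cong-≗ (λ c → ∑maps-*ˡ n a (λ ψ → f (c ∷ ψ))))
                             (sym (*-distribˡ-sum a (λ c → ∑maps n (λ ψ → f (c ∷ ψ)))))

∑maps-∑-comm : ∀ n {k} (f : Fin k → Vec (Fin 3) n → ℕ) →
  ∑maps n (λ ψ → ∑[ i < k ] f i ψ) ≡ ∑[ i < k ] ∑maps n (f i)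
∑maps-∑-comm zero f = refl
∑maps-∑-comm (suc n) f =
  trans (sum-cong-≗ (λ c → ∑maps-∑-comm n (λ i ψ → f i (c ∷ ψ))))
        (∑-comm (λ c i → ∑maps n (λ ψ → f i (c ∷ ψ))))

∑maps-insertAt : ∀ n (v : Fin (suc n)) (h : Vec (Fin 3) (suc n) → ℕ) →
  ∑maps (suc n) h ≡ ∑[ c < 3 ] ∑maps n (λ ψ → h (insertAt ψ v c))
∑maps-insertAt n zero h = refl
∑maps-insertAt (suc n) (suc v) h =
  trans (sum-cong-≗ (λ x → ∑maps-insertAt n v (λ ψ → h (x ∷ ψ))))
        (∑-comm (λ x c → ∑maps n (λ ψ → h (x ∷ insertAt ψ v c))))

sum-map-allMaps : ∀ n (h : Vec (Fin 3) n → ℕ) → sum (map h (allMaps n)) ≡ ∑maps n h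
sum-map-allMaps zero h = +-identityʳ (h [])
sum-map-allMaps (suc n) h = begin
  sum (map h (concatMap (λ c → map (c ∷_) (allMaps n)) (allFin 3)))
    ≡⟨ cong sum (List.map-concatMap h (λ c → map (c ∷_) (allMaps n)) (allFin 3)) ⟩
  sum (concatMap (λ c → map h (map (c ∷_) (allMaps n))) (allFin 3))
    ≡⟨ sum-concatMap (λ c → map h (map (c ∷_) (allMaps n))) (allFin 3) ⟩
  sum (map (λ c → sum (map h (map (c ∷_) (allMaps n)))) (allFin 3))
    ≡⟨ sum-map-allFin 3 (λ c → sum (map h (map (c ∷_) (allMaps n)))) ⟩
  ∑[ c < 3 ] sum (map h (map (c ∷_) (allMaps n)))
    ≡⟨ sum-cong-≗ (λ c → trans (cong sum (sym (List.map-∘ {g = h} {f = c ∷_} (allMaps n))))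
                                 (sum-map-allMaps n (λ ψ → h (c ∷ ψ)))) ⟩
  ∑maps (suc n) h ∎
  where open ≡-Reasoning

pattern 𝐚 = zero
pattern 𝐛 = suc zero
pattern 𝐜 = suc (suc zero)

jAdj-sym : ∀ s t → jAdj s t ≡ jAdj t s
jAdj-sym 𝐚 𝐚 = refl
jAdj-sym 𝐚 𝐛 = refl
jAdj-sym 𝐚 𝐜 = refl
jAdj-sym 𝐛 𝐚 = refl
jAdj-sym 𝐛 𝐛 = refl
jAdj-sym 𝐛 𝐜 = refl
jAdj-sym 𝐜 𝐚 = refl
jAdj-sym 𝐜 𝐛 = refl
jAdj-sym 𝐜 𝐜 = refl

jAdj-a⇒b : ∀ s → jAdj 𝐚 s ≡ true → jAdj 𝐛 s ≡ true
jAdj-a⇒b 𝐛 _ = refl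

jDegree : Fin 3 → ℕ
jDegree x = ∑[ c < 3 ] 𝟙 (jAdj c x)

Hom : ∀ {n} → Graph n → Vec (Fin 3) n → Set
Hom {n} G φ = ∀ x y → G x y ≡ true → jAdj (lookup φ x) (lookup φ y) ≡ true

isHom⇒Hom : ∀ {n} (G : Graph n) φ → isHom G φ ≡ true → Hom G φ
isHom⇒Hom {n} G φ isHom-φ x y Gxy = subst (λ b → not b ∨ _ ≡ true) Gxy (edge-ok y)
  where
  row-ok : ∀ x → List.foldr _∧_ true (map (λ y → not (G x y) ∨ jAdj (lookup φ x) (lookup φ y)) (allFin n)) ≡ true
  row-ok = all-true⁻ _ (trans (sym (and-map-allFin n _)) (trans (sym (and-concatMap _ (allFin n))) isHom-φ))
  edge-ok : ∀ y → not (G x y) ∨ jAdj (lookup φ x) (lookup φ y) ≡ true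
  edge-ok = all-true⁻ _ (trans (sym (and-map-allFin n _)) (row-ok x))

Hom⇒isHom : ∀ {n} (G : Graph n) φ → Hom G φ → isHom G φ ≡ true
Hom⇒isHom {n} G φ hom =
  trans (and-concatMap _ (allFin n)) (trans (and-map-allFin n _) (all-true⁺ _ λ x →
    trans (and-map-allFin n _) (all-true⁺ _ (edge-ok x))))
  where
  edge-ok : ∀ x y → not (G x y) ∨ jAdj (lookup φ x) (lookup φ y) ≡ true
  edge-ok x y with G x y in Gxy
  ... | true  = hom x y Gxy
  ... | false = refl

𝟙-hom : ∀ {n} → Graph n → Vec (Fin 3) n → ℕ
𝟙-hom G φ = 𝟙 (isHom G φ)

𝟙-hom-mono : ∀ {n k} (G : Graph n) (H : Graph k) φ ψ → (Hom G φ → Hom H ψ) → 𝟙-hom G φ ≤ 𝟙-hom H ψ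
𝟙-hom-mono G H φ ψ G⇒H = 𝟙-mono (Hom⇒isHom H ψ ∘ G⇒H ∘ isHom⇒Hom G φ)

𝟙-hom-cong : ∀ {n k} (G : Graph n) (H : Graph k) φ ψ → (Hom G φ → Hom H ψ) → (Hom H ψ → Hom G φ) →
  𝟙-hom G φ ≡ 𝟙-hom H ψ
𝟙-hom-cong G H φ ψ G⇒H H⇒G = ≤-antisym (𝟙-hom-mono G H φ ψ G⇒H) (𝟙-hom-mono H G ψ φ H⇒G)

𝟙-hom-factor : ∀ {n k} (G : Graph n) (H : Graph k) φ ψ (p : Bool) →
  (Hom G φ → p ≡ true × Hom H ψ) → (p ≡ true → Hom H ψ → Hom G φ) → 𝟙-hom G φ ≡ 𝟙 p * 𝟙-hom H ψ
𝟙-hom-factor G H φ ψ p G⇒H H⇒G = trans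
  (≤-antisym (𝟙-mono λ G-φ → let (p-true , H-ψ) = G⇒H (isHom⇒Hom G φ G-φ) in ∧-true⁺ p-true (Hom⇒isHom H ψ H-ψ))
             (𝟙-mono λ p∧H-ψ → let (p-true , H-ψ) = ∧-true⁻ p∧H-ψ in Hom⇒isHom G φ (H⇒G p-true (isHom⇒Hom H ψ H-ψ))))
  (𝟙-∧ p (isHom H ψ))

length-filterᵇ : ∀ {A : Set} (p : A → Bool) xs → length (filterᵇ p xs) ≡ sum (map (𝟙 ∘ p) xs)
length-filterᵇ p [] = refl
length-filterᵇ p (x ∷ xs) with p x
... | true  = cong suc (length-filterᵇ p xs)
... | false = length-filterᵇ p xs

jHom≡∑maps : ∀ {n} (G : Graph n) → jHom G ≡ ∑maps n (𝟙-hom G)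
jHom≡∑maps {n} G = trans (length-filterᵇ (isHom G) (allMaps n)) (sum-map-allMaps n (𝟙-hom G))

jHom-cong : ∀ {n} {G H : Graph n} → (∀ x y → G x y ≡ H x y) → jHom G ≡ jHom H
jHom-cong {n} {G} {H} G≗H = trans (jHom≡∑maps G) (trans (∑maps-cong n λ φ → 𝟙-hom-cong G H φ φ
  (λ hom x y Hxy → hom x y (trans (G≗H x y) Hxy)) (λ hom x y Gxy → hom x y (trans (sym (G≗H x y)) Gxy)))
  (sym (jHom≡∑maps H)))

removeVertex : ∀ {n} → Graph (suc n) → Fin (suc n) → Graph n
removeVertex G v x y = G (punchIn v x) (punchIn v y)

Simple-removeVertex : ∀ {n} {G : Graph (suc n)} v → Simple G → Simple (removeVertex G v)
Simple-removeVertex v (sym-G , loopless-G) = (λ x y → sym-G _ _) , (λ x → loopless-G _)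

data PunchInView {n} (v : Fin (suc n)) : Fin (suc n) → Set where
  at-v    : PunchInView v v
  punched : ∀ x → PunchInView v (punchIn v x)

punchInView : ∀ {n} (v x : Fin (suc n)) → PunchInView v x
punchInView v x with v Fin.≟ x
... | yes refl = at-v
... | no v≢x = subst (PunchInView v) (Fin.punchIn-punchOut v≢x) (punched (punchOut v≢x))

AdjacentToNeighbours : ∀ {n} → Graph (suc n) → Fin (suc n) → Vec (Fin 3) n → Fin 3 → Set
AdjacentToNeighbours G v ψ c = ∀ t → G v (punchIn v t) ≡ true → jAdj c (lookup ψ t) ≡ true

hom-insertAt⁻ : ∀ {n} (G : Graph (suc n)) v ψ c → Hom G (insertAt ψ v c) →
  Hom (removeVertex G v) ψ × AdjacentToNeighbours G v ψ c
hom-insertAt⁻ G v ψ c hom =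
  (λ x y Gxy → subst₂ (λ s t → jAdj s t ≡ true) (insertAt-punchIn ψ v c x) (insertAt-punchIn ψ v c y) (hom _ _ Gxy)) ,
  (λ t Gvt → subst₂ (λ s t → jAdj s t ≡ true) (insertAt-lookup ψ v c) (insertAt-punchIn ψ v c t) (hom _ _ Gvt))

hom-insertAt⁺ : ∀ {n} (G : Graph (suc n)) v ψ c → Simple G →
  Hom (removeVertex G v) ψ → AdjacentToNeighbours G v ψ c → Hom G (insertAt ψ v c)
hom-insertAt⁺ G v ψ c (sym-G , loopless-G) hom adj x y Gxy with punchInView v x | punchInView v y
... | at-v      | at-v      = contradiction (trans (sym Gxy) (loopless-G v)) λ ()
... | at-v      | punched t = subst₂ (λ s t → jAdj s t ≡ true) (sym (insertAt-lookup ψ v c)) (sym (insertAt-punchIn ψ v c t))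
                                (adj t Gxy)
... | punched t | at-v      = subst₂ (λ s t → jAdj s t ≡ true) (sym (insertAt-punchIn ψ v c t)) (sym (insertAt-lookup ψ v c))
                                (trans (jAdj-sym (lookup ψ t) c) (adj t (trans (sym-G v _) Gxy)))
... | punched s | punched t = subst₂ (λ s t → jAdj s t ≡ true) (sym (insertAt-punchIn ψ v c s)) (sym (insertAt-punchIn ψ v c t))
                                (hom s t Gxy)

hom-insertAt-a⇒b : ∀ {n} (G : Graph (suc n)) v ψ → Simple G → Hom G (insertAt ψ v 𝐚) → Hom G (insertAt ψ v 𝐛)
hom-insertAt-a⇒b G v ψ simple-G hom =
  let (hom-G-v , adj) = hom-insertAt⁻ G v ψ 𝐚 hom
  in hom-insertAt⁺ G v ψ 𝐛 simple-G hom-G-v (λ t Gvt → jAdj-a⇒b (lookup ψ t) (adj t Gvt))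

¬hom-insertAt-c : ∀ {n} (G : Graph (suc n)) v ψ t → G v (punchIn v t) ≡ true → ¬ Hom G (insertAt ψ v 𝐜)
¬hom-insertAt-c G v ψ t Gvt hom = contradiction (proj₂ (hom-insertAt⁻ G v ψ 𝐜 hom) t Gvt) λ ()

Isolated : ∀ {n} → Graph (suc n) → Fin (suc n) → Set
Isolated {n} G v = ∀ (t : Fin n) → G v (punchIn v t) ≡ false

𝟙-hom-insertAt-isolated : ∀ {n} (G : Graph (suc n)) v ψ c → Simple G → Isolated G v →
  𝟙-hom G (insertAt ψ v c) ≡ 𝟙-hom (removeVertex G v) ψ
𝟙-hom-insertAt-isolated G v ψ c simple-G isolated-v = 𝟙-hom-cong G (removeVertex G v) (insertAt ψ v c) ψ
  (proj₁ ∘ hom-insertAt⁻ G v ψ c)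
  (λ hom → hom-insertAt⁺ G v ψ c simple-G hom λ t Gvt → contradiction (trans (sym Gvt) (isolated-v t)) λ ())

jHom-isolated : ∀ {n} (G : Graph (suc n)) v → Simple G → Isolated G v → jHom G ≡ 3 * jHom (removeVertex G v)
jHom-isolated {n} G v simple-G isolated-v = begin
  jHom G
    ≡⟨ jHom≡∑maps G ⟩
  ∑maps (suc n) (𝟙-hom G)
    ≡⟨ ∑maps-insertAt n v (𝟙-hom G) ⟩
  ∑[ c < 3 ] ∑maps n (λ ψ → 𝟙-hom G (insertAt ψ v c))
    ≡⟨ sum-cong-≗ (λ c → ∑maps-cong n λ ψ →
      𝟙-hom-insertAt-isolated G v ψ c simple-G isolated-v) ⟩
  3 * ∑maps n (𝟙-hom (removeVertex G v))
    ≡⟨ cong (3 *_) (jHom≡∑maps (removeVertex G v)) ⟨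
  3 * jHom (removeVertex G v) ∎
  where open ≡-Reasoning

jHom-leaf : ∀ {n} (G : Graph (suc n)) v u → Simple G →
  G v (punchIn v u) ≡ true → (∀ t → G v (punchIn v t) ≡ true → t ≡ u) →
  jHom G ≡ ∑maps n (λ ψ → jDegree (lookup ψ u) * 𝟙-hom (removeVertex G v) ψ)
jHom-leaf {n} G v u simple-G Gvu only-u = begin
  jHom G
    ≡⟨ jHom≡∑maps G ⟩
  ∑maps (suc n) (𝟙-hom G)
    ≡⟨ ∑maps-insertAt n v (𝟙-hom G) ⟩
  ∑[ c < 3 ] ∑maps n (λ ψ → 𝟙-hom G (insertAt ψ v c))
    ≡⟨ sum-cong-≗ (λ c → ∑maps-cong n (factor c)) ⟩
  ∑[ c < 3 ] ∑maps n (λ ψ → 𝟙 (jAdj c (lookup ψ u)) * 𝟙-hom H ψ)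
    ≡⟨ ∑maps-∑-comm n (λ c ψ → 𝟙 (jAdj c (lookup ψ u)) * 𝟙-hom H ψ) ⟨
  ∑maps n (λ ψ → ∑[ c < 3 ] (𝟙 (jAdj c (lookup ψ u)) * 𝟙-hom H ψ))
    ≡⟨ ∑maps-cong n (λ ψ → *-distribʳ-sum (𝟙-hom H ψ) (λ c → 𝟙 (jAdj c (lookup ψ u)))) ⟨
  ∑maps n (λ ψ → jDegree (lookup ψ u) * 𝟙-hom H ψ) ∎
  where
  open ≡-Reasoning
  H = removeVertex G v
  factor : ∀ c ψ → 𝟙-hom G (insertAt ψ v c) ≡ 𝟙 (jAdj c (lookup ψ u)) * 𝟙-hom H ψ
  factor c ψ = 𝟙-hom-factor G H (insertAt ψ v c) ψ (jAdj c (lookup ψ u))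
    (λ hom → let (H-ψ , adj) = hom-insertAt⁻ G v ψ c hom in adj u Gvu , H-ψ)
    (λ adj-u H-ψ → hom-insertAt⁺ G v ψ c simple-G H-ψ λ t Gvt →
      subst (λ t → jAdj c (lookup ψ t) ≡ true) (sym (only-u t Gvt)) adj-u)

_∪_ : ∀ {n} → Graph n → Graph n → Graph n
(G ∪ H) x y = G x y ∨ H x y

arc : ∀ {n} → Fin n → Fin n → Graph n
arc s t x y = does (x Fin.≟ s) ∧ does (y Fin.≟ t)

singleEdge : ∀ {n} → Fin n → Fin n → Graph n
singleEdge s t = arc s t ∪ arc t s

Simple-∪ : ∀ {n} {G H : Graph n} → Simple G → Simple H → Simple (G ∪ H)
Simple-∪ (sym-G , loopless-G) (sym-H , loopless-H) =
  (λ x y → cong₂ _∨_ (sym-G x y) (sym-H x y)) , (λ x → cong₂ _∨_ (loopless-G x) (loopless-H x))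

arc-endpoints : ∀ {n} (s t x y : Fin n) → arc s t x y ≡ true → x ≡ s × y ≡ t
arc-endpoints s t x y e with x Fin.≟ s | y Fin.≟ t
... | yes x≡s | yes y≡t = x≡s , y≡t

arc-at-endpoints : ∀ {n} (s t : Fin n) → arc s t s t ≡ true
arc-at-endpoints s t rewrite dec-true (s Fin.≟ s) refl | dec-true (t Fin.≟ t) refl = refl

singleEdge-true⁻ : ∀ {n} (s t x y : Fin n) → singleEdge s t x y ≡ true → (x ≡ s × y ≡ t) ⊎ (x ≡ t × y ≡ s)
singleEdge-true⁻ s t x y e with ∨-true⁻ e
... | inj₁ st = inj₁ (arc-endpoints s t x y st)
... | inj₂ ts = inj₂ (arc-endpoints t s x y ts)

Simple-singleEdge : ∀ {n} (s t : Fin n) → s ≢ t → Simple (singleEdge s t)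
Simple-singleEdge s t s≢t = symmetric , loopless
  where
  symmetric : ∀ x y → singleEdge s t x y ≡ singleEdge s t y x
  symmetric x y = trans (cong₂ _∨_ (∧-comm (does (x Fin.≟ s)) (does (y Fin.≟ t))) (∧-comm (does (x Fin.≟ t)) (does (y Fin.≟ s))))
                        (∨-comm (arc t s y x) (arc s t y x))
  loopless : ∀ x → singleEdge s t x x ≡ false
  loopless x = ¬-not λ e → s≢t (case singleEdge-true⁻ s t x x e of λ
    { (inj₁ (x≡s , x≡t)) → trans (sym x≡s) x≡t
    ; (inj₂ (x≡t , x≡s)) → trans (sym x≡s) x≡t })

hom-∪⁻ : ∀ {n} (G H : Graph n) φ → Hom (G ∪ H) φ → Hom G φ × Hom H φ
hom-∪⁻ G H φ hom = (λ x y Gxy → hom x y (cong (_∨ H x y) Gxy)) ,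
                   (λ x y Hxy → hom x y (trans (cong (G x y ∨_) Hxy) (∨-zeroʳ (G x y))))

hom-∪⁺ : ∀ {n} (G H : Graph n) φ → Hom G φ → Hom H φ → Hom (G ∪ H) φ
hom-∪⁺ G H φ hom-G hom-H x y e with G x y in Gxy
... | true  = hom-G x y Gxy
... | false = hom-H x y e

hom-arc⁺ : ∀ {n} (s t : Fin n) φ → jAdj (lookup φ s) (lookup φ t) ≡ true → Hom (arc s t) φ
hom-arc⁺ s t φ adj x y e with arc-endpoints s t x y e
... | refl , refl = adj

jHom-addEdge : ∀ {n} (H : Graph n) s t →
  jHom (H ∪ singleEdge s t) ≡ ∑maps n (λ φ → 𝟙 (jAdj (lookup φ s) (lookup φ t)) * 𝟙-hom H φ)
jHom-addEdge {n} H s t = trans (jHom≡∑maps (H ∪ singleEdge s t)) (∑maps-cong n λ φ →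
  𝟙-hom-factor (H ∪ singleEdge s t) H φ φ (jAdj (lookup φ s) (lookup φ t))
    (λ hom → let (hom-H , hom-st) = hom-∪⁻ H (singleEdge s t) φ hom
             in proj₁ (hom-∪⁻ (arc s t) (arc t s) φ hom-st) s t (arc-at-endpoints s t) , hom-H)
    (λ adj hom-H → hom-∪⁺ H (singleEdge s t) φ hom-H (hom-∪⁺ (arc s t) (arc t s) φ
      (hom-arc⁺ s t φ adj) (hom-arc⁺ t s φ (trans (jAdj-sym (lookup φ t) (lookup φ s)) adj)))))

-- Degrees and edges

edges : ∀ {n} → Graph n → ℕ
edges {n} G = ∑[ x < n ] ∑[ y < n ] 𝟙 ((toℕ x <ᵇ toℕ y) ∧ G x y)

edgeCount≡edges : ∀ {n} (G : Graph n) → edgeCount G ≡ edges G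
edgeCount≡edges {n} G = begin
  edgeCount G                                            ≡⟨ sum-concatMap (λ x → map (edge x) (allFin n)) (allFin n) ⟩
  sum (map (λ x → sum (map (edge x) (allFin n))) (allFin n)) ≡⟨ sum-map-allFin n _ ⟩
  ∑[ x < n ] sum (map (edge x) (allFin n))               ≡⟨ sum-cong-≗ (λ x → sum-map-allFin n (edge x)) ⟩
  edges G                                                ∎
  where
  open ≡-Reasoning
  edge : Fin n → Fin n → ℕ
  edge x y = 𝟙 ((toℕ x <ᵇ toℕ y) ∧ G x y)

edges-cong : ∀ {n} {G H : Graph n} → (∀ x y → G x y ≡ H x y) → edges G ≡ edges H
edges-cong G≗H = sum-cong-≗ λ x → sum-cong-≗ λ y → cong (λ b → 𝟙 ((toℕ x <ᵇ toℕ y) ∧ b)) (G≗H x y)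

degree : ∀ {n} → Graph n → Fin n → ℕ
degree {n} G x = ∑[ y < n ] 𝟙 (G x y)

degreeSum : ∀ {n} → Graph n → ℕ
degreeSum {n} G = ∑[ x < n ] degree G x

degree-punchIn : ∀ {n} (G : Graph (suc n)) v → G v v ≡ false → degree G v ≡ ∑[ t < n ] 𝟙 (G v (punchIn v t))
degree-punchIn G v Gvv≡false =
  trans (sum-remove {i = v} (𝟙 ∘ G v)) (cong (λ b → 𝟙 b + ∑[ t < _ ] 𝟙 (G v (punchIn v t))) Gvv≡false)

degree-isolated : ∀ {n} (G : Graph (suc n)) v → Simple G → Isolated G v → degree G v ≡ 0
degree-isolated {n} G v (_ , loopless-G) isolated-v =
  trans (degree-punchIn G v (loopless-G v)) (trans (sum-cong-≗ (cong 𝟙 ∘ isolated-v)) (trans (∑-const n 0) (*-zeroʳ n)))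

degree≡0⇒isolated : ∀ {n} (G : Graph (suc n)) v → Simple G → degree G v ≡ 0 → Isolated G v
degree≡0⇒isolated G v (_ , loopless-G) d≡0 = ∑-𝟙≡0 (G v ∘ punchIn v) (trans (sym (degree-punchIn G v (loopless-G v))) d≡0)

degreeSum-removeVertex : ∀ {n} (G : Graph (suc n)) v → Simple G →
  degreeSum G ≡ 2 * degree G v + degreeSum (removeVertex G v)
degreeSum-removeVertex {n} G v (sym-G , loopless-G) = begin
  degreeSum G
    ≡⟨ sum-remove {i = v} (degree G) ⟩
  degree G v + ∑[ x < n ] degree G (punchIn v x)
    ≡⟨ cong (degree G v +_) (sum-cong-≗ λ x → sum-remove {i = v} (𝟙 ∘ G (punchIn v x))) ⟩
  degree G v + ∑[ x < n ] (𝟙 (G (punchIn v x) v) + degree G-v x)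
    ≡⟨ cong (degree G v +_) (∑-distrib-+ (λ x → 𝟙 (G (punchIn v x) v)) (degree G-v)) ⟩
  degree G v + (∑[ x < n ] 𝟙 (G (punchIn v x) v) + degreeSum G-v)
    ≡⟨ cong (λ d → degree G v + (d + degreeSum G-v)) v-row ⟩
  degree G v + (degree G v + degreeSum G-v)
    ≡⟨ cong (λ d → degree G v + (d + degreeSum G-v)) (+-identityʳ (degree G v)) ⟨
  degree G v + ((degree G v + 0) + degreeSum G-v)
    ≡⟨ +-assoc (degree G v) _ _ ⟨
  2 * degree G v + degreeSum G-v ∎
  where
  open ≡-Reasoning
  G-v = removeVertex G v
  v-row : ∑[ x < n ] 𝟙 (G (punchIn v x) v) ≡ degree G v
  v-row = trans (sum-cong-≗ λ x → cong 𝟙 (sym-G (punchIn v x) v)) (sym (degree-punchIn G v (loopless-G v)))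

handshake : ∀ {n} (G : Graph n) → Simple G → degreeSum G ≡ 2 * edges G
handshake {zero} G _ = refl
handshake {suc n} G simple-G@(_ , loopless-G) = begin
  degreeSum G
    ≡⟨ degreeSum-removeVertex G zero simple-G ⟩
  2 * degree G zero + degreeSum G-0
    ≡⟨ cong₂ (λ d e → 2 * d + e) (degree-punchIn G zero (loopless-G zero))
      (handshake G-0 (Simple-removeVertex zero simple-G)) ⟩
  2 * ∑[ t < n ] 𝟙 (G zero (suc t)) + 2 * edges G-0
    ≡⟨ *-distribˡ-+ 2 (∑[ t < n ] 𝟙 (G zero (suc t))) (edges G-0) ⟨
  2 * edges G ∎
  where
  open ≡-Reasoning
  G-0 = removeVertex G zero

edges-removeVertex : ∀ {n} (G : Graph (suc n)) v → Simple G → edges G ≡ degree G v + edges (removeVertex G v)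
edges-removeVertex G v simple-G = *-cancelˡ-≡ (edges G) (degree G v + edges G-v) 2 (begin
  2 * edges G                               ≡⟨ handshake G simple-G ⟨
  degreeSum G                               ≡⟨ degreeSum-removeVertex G v simple-G ⟩
  2 * degree G v + degreeSum G-v            ≡⟨ cong (2 * degree G v +_) (handshake G-v (Simple-removeVertex v simple-G)) ⟩
  2 * degree G v + 2 * edges G-v            ≡⟨ *-distribˡ-+ 2 (degree G v) (edges G-v) ⟨
  2 * (degree G v + edges G-v)              ∎)
  where
  open ≡-Reasoning
  G-v = removeVertex G v

degree≤edges : ∀ {n} (G : Graph n) → Simple G → ∀ v → degree G v ≤ edges G
degree≤edges {suc n} G simple-G v = subst (degree G v ≤_) (sym (edges-removeVertex G v simple-G)) (m≤m+n _ _)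

∃-degree≤1 : ∀ {n} (G : Graph n) → Simple G → edges G < n → ∃ λ v → degree G v ≤ 1
∃-degree≤1 {n} G simple-G few-edges with Fin.any? (λ v → degree G v ≤? 1)
... | yes low-degree = low-degree
... | no ¬low-degree = contradiction (begin-strict
  2 * n                  ≡⟨ trans (*-comm 2 n) (sym (∑-const n 2)) ⟩
  ∑[ v < n ] 2           ≤⟨ sum-mono-≤ (λ v → ≰⇒> (λ d≤1 → ¬low-degree (v , d≤1))) ⟩
  degreeSum G            ≡⟨ handshake G simple-G ⟩
  2 * edges G            <⟨ *-monoʳ-< 2 few-edges ⟩
  2 * n                  ∎) (<-irrefl refl)
  where open ≤-Reasoning

∃-non-neighbour : ∀ {n} (G : Graph (suc n)) → Simple G → edges G < n → ∀ u → ∃ λ t → G u (punchIn u t) ≡ false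
∃-non-neighbour {n} G simple-G@(_ , loopless-G) few-edges u with Fin.any? (λ t → G u (punchIn u t) Bool.≟ false)
... | yes non-neighbour = non-neighbour
... | no ¬non-neighbour = contradiction (begin-strict
  n                                   ≡⟨ trans (sym (*-identityʳ n)) (sym (∑-const n 1)) ⟩
  ∑[ t < n ] 1                        ≡⟨ sum-cong-≗ adjacent ⟨
  ∑[ t < n ] 𝟙 (G u (punchIn u t))     ≡⟨ degree-punchIn G u (loopless-G u) ⟨
  degree G u                          ≤⟨ degree≤edges G simple-G u ⟩
  edges G                             <⟨ few-edges ⟩
  n                                   ∎) (<-irrefl refl)
  where
  open ≤-Reasoning
  adjacent : ∀ t → 𝟙 (G u (punchIn u t)) ≡ 1
  adjacent t with G u (punchIn u t) in Gut
  ... | true  = refl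
  ... | false = contradiction (t , Gut) ¬non-neighbour

degreeSum-∪ : ∀ {n} (G H : Graph n) → (∀ x y → G x y ≡ true → H x y ≡ false) →
  degreeSum (G ∪ H) ≡ degreeSum G + degreeSum H
degreeSum-∪ {n} G H disjoint = trans
  (sum-cong-≗ λ x → trans (sum-cong-≗ (𝟙-∨ x)) (∑-distrib-+ (𝟙 ∘ G x) (𝟙 ∘ H x)))
  (∑-distrib-+ (degree G) (degree H))
  where
  𝟙-∨ : ∀ x y → 𝟙 (G x y ∨ H x y) ≡ 𝟙 (G x y) + 𝟙 (H x y)
  𝟙-∨ x y with G x y in Gxy
  ... | true  = cong (λ b → 1 + 𝟙 b) (sym (disjoint x y Gxy))
  ... | false = refl

degreeSum-arc : ∀ {n} (s t : Fin n) → degreeSum (arc s t) ≡ 1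
degreeSum-arc {n} s t = begin
  ∑[ x < n ] ∑[ y < n ] 𝟙 (arc s t x y)    ≡⟨ sum-cong-≗ (λ x → sum-cong-≗ λ y → 𝟙-∧ (does (x Fin.≟ s)) (does (y Fin.≟ t))) ⟩
  ∑[ x < n ] ∑[ y < n ] (δ s x * δ t y)    ≡⟨ sum-cong-≗ (λ x → *-distribˡ-sum (δ s x) (δ t)) ⟨
  ∑[ x < n ] (δ s x * ∑[ y < n ] δ t y)    ≡⟨ sum-cong-≗ (λ x → trans (cong (δ s x *_) (∑-𝟙-≟ t)) (*-identityʳ (δ s x))) ⟩
  ∑[ x < n ] δ s x                         ≡⟨ ∑-𝟙-≟ s ⟩
  1                                        ∎
  where
  open ≡-Reasoning
  δ : Fin n → Fin n → ℕ
  δ s x = 𝟙 (does (x Fin.≟ s))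

degreeSum-singleEdge : ∀ {n} (s t : Fin n) → s ≢ t → degreeSum (singleEdge s t) ≡ 2
degreeSum-singleEdge s t s≢t = trans
  (degreeSum-∪ (arc s t) (arc t s) λ x y st → ¬-not λ ts →
    s≢t (trans (sym (proj₁ (arc-endpoints s t x y st))) (proj₁ (arc-endpoints t s x y ts))))
  (cong₂ _+_ (degreeSum-arc s t) (degreeSum-arc t s))

edges-addEdge : ∀ {n} (H : Graph n) s t → Simple H → s ≢ t → H s t ≡ false → edges (H ∪ singleEdge s t) ≡ suc (edges H)
edges-addEdge H s t simple-H@(sym-H , _) s≢t Hst≡false = *-cancelˡ-≡ _ _ 2 (begin
  2 * edges (H ∪ singleEdge s t)           ≡⟨ handshake (H ∪ singleEdge s t) (Simple-∪ simple-H (Simple-singleEdge s t s≢t)) ⟨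
  degreeSum (H ∪ singleEdge s t)           ≡⟨ degreeSum-∪ H (singleEdge s t) disjoint ⟩
  degreeSum H + degreeSum (singleEdge s t) ≡⟨ cong₂ _+_ (handshake H simple-H) (degreeSum-singleEdge s t s≢t) ⟩
  2 * edges H + 2                          ≡⟨ +-comm (2 * edges H) 2 ⟩
  2 + 2 * edges H                          ≡⟨ *-suc 2 (edges H) ⟨
  2 * suc (edges H)                        ∎)
  where
  open ≡-Reasoning
  disjoint : ∀ x y → H x y ≡ true → singleEdge s t x y ≡ false
  disjoint x y Hxy = ¬-not λ e → contradiction Hst≡false (case singleEdge-true⁻ s t x y e of λ
    { (inj₁ (refl , refl)) → λ Hst≡false → contradiction (trans (sym Hxy) Hst≡false) λ ()
    ; (inj₂ (refl , refl)) → λ Hst≡false → contradiction (trans (sym Hxy) (trans (sym-H t s) Hst≡false)) λ () })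

-- Pruning a vertex of degree at most one

-- How the number of homomorphisms depends on the colour y of one vertex w: if w has a neighbour,
-- y = c is impossible and y = a can be changed to y = b; if w is isolated, y is irrelevant.
HomProfile : (Fin 3 → ℕ) → Set
HomProfile h = (h 𝐜 ≡ 0 × h 𝐚 ≤ h 𝐛) ⊎ (h 𝐚 ≡ h 𝐜 × h 𝐛 ≡ h 𝐜)

HomProfile-insertAt : ∀ {n} (H : Graph (suc n)) w ψ → Simple H → HomProfile (λ y → 𝟙-hom H (insertAt ψ w y))
HomProfile-insertAt H w ψ simple-H with Fin.any? (λ t → H w (punchIn w t) Bool.≟ true)
... | yes (t , Hwt) = inj₁
  ( n≤0⇒n≡0 (𝟙-mono λ hom-c → contradiction (isHom⇒Hom H (insertAt ψ w 𝐜) hom-c) (¬hom-insertAt-c H w ψ t Hwt))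
  , 𝟙-hom-mono H H (insertAt ψ w 𝐚) (insertAt ψ w 𝐛) (hom-insertAt-a⇒b H w ψ simple-H))
... | no ¬adjacent = inj₂ (trans (forget-w 𝐚) (sym (forget-w 𝐜)) , trans (forget-w 𝐛) (sym (forget-w 𝐜)))
  where
  forget-w : ∀ y → 𝟙-hom H (insertAt ψ w y) ≡ 𝟙-hom (removeVertex H w) ψ
  forget-w y = 𝟙-hom-insertAt-isolated H w ψ y simple-H λ t → ¬-not λ Hwt → ¬adjacent (t , Hwt)

jDegree-weighted-≤ : ∀ x (h : Fin 3 → ℕ) → HomProfile h →
  jDegree x * ∑[ y < 3 ] h y ≤ 3 * ∑[ y < 3 ] (𝟙 (jAdj x y) * h y)
jDegree-weighted-≤ x h = weighted x (h 𝐚) (h 𝐛) (h 𝐜)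
  where
  open ≤-Reasoning
  a-lhs : ∀ ha hb → 1 * (ha + (hb + (0 + 0))) ≡ ha + hb
  a-lhs = solve-∀
  a-rhs : ∀ hb → hb + (hb + hb) ≡ 3 * (1 * hb + 0)
  a-rhs = solve-∀
  b-lhs : ∀ ha hb → 2 * (ha + (hb + (0 + 0))) ≡ 2 * (ha + hb)
  b-lhs = solve-∀
  b-rhs : ∀ ha hb → 3 * (ha + hb) ≡ 3 * (1 * ha + (1 * hb + 0))
  b-rhs = solve-∀
  a-isolated : ∀ k → 1 * (k + (k + (k + 0))) ≡ 3 * (1 * k + 0)
  a-isolated = solve-∀
  b-isolated : ∀ k → 2 * (k + (k + (k + 0))) ≡ 3 * (1 * k + (1 * k + 0))
  b-isolated = solve-∀
  weighted : ∀ x ha hb hc → (hc ≡ 0 × ha ≤ hb) ⊎ (ha ≡ hc × hb ≡ hc) →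
    jDegree x * (ha + (hb + (hc + 0))) ≤ 3 * (𝟙 (jAdj x 𝐚) * ha + (𝟙 (jAdj x 𝐛) * hb + (𝟙 (jAdj x 𝐜) * hc + 0)))
  weighted 𝐚 ha hb .0 (inj₁ (refl , ha≤hb)) = begin
    1 * (ha + (hb + (0 + 0)))    ≡⟨ a-lhs ha hb ⟩
    ha + hb                      ≤⟨ +-monoˡ-≤ hb ha≤hb ⟩
    hb + hb                      ≤⟨ m≤n+m (hb + hb) hb ⟩
    hb + (hb + hb)               ≡⟨ a-rhs hb ⟩
    3 * (1 * hb + 0)             ∎
  weighted 𝐛 ha hb .0 (inj₁ (refl , _)) = begin
    2 * (ha + (hb + (0 + 0)))    ≡⟨ b-lhs ha hb ⟩
    2 * (ha + hb)                ≤⟨ *-monoˡ-≤ (ha + hb) (n≤1+n 2) ⟩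
    3 * (ha + hb)                ≡⟨ b-rhs ha hb ⟩
    3 * (1 * ha + (1 * hb + 0))  ∎
  weighted 𝐚 .k .k k (inj₂ (refl , refl)) = ≤-reflexive (a-isolated k)
  weighted 𝐛 .k .k k (inj₂ (refl , refl)) = ≤-reflexive (b-isolated k)
  weighted 𝐜 _ _ _ _ = z≤n

jHom-leaf-≤ : ∀ {n} (G : Graph (suc (suc n))) v u w → Simple G →
  G v (punchIn v u) ≡ true → (∀ t → G v (punchIn v t) ≡ true → t ≡ u) → u ≢ w →
  jHom G ≤ 3 * jHom (removeVertex G v ∪ singleEdge u w)
jHom-leaf-≤ {n} G v u w simple-G Gvu only-u u≢w with punchInView w u
... | at-v       = contradiction refl u≢w
... | punched u′ = begin
  jHom G
    ≡⟨ jHom-leaf G v u simple-G Gvu only-u ⟩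
  ∑maps (suc n) (λ φ → jDegree (lookup φ u) * 𝟙-hom H φ)
    ≡⟨ ∑maps-insertAt n w (λ φ → jDegree (lookup φ u) * 𝟙-hom H φ) ⟩
  ∑[ y < 3 ] ∑maps n (λ ψ → jDegree (colour ψ y u) * h ψ y)
    ≡⟨ ∑maps-∑-comm n (λ y ψ → jDegree (colour ψ y u) * h ψ y) ⟨
  ∑maps n (λ ψ → ∑[ y < 3 ] (jDegree (colour ψ y u) * h ψ y))
    ≤⟨ ∑maps-mono-≤ n pointwise ⟩
  ∑maps n (λ ψ → 3 * ∑[ y < 3 ] (edge-ok ψ y * h ψ y))
    ≡⟨ ∑maps-*ˡ n 3 (λ ψ → ∑[ y < 3 ] (edge-ok ψ y * h ψ y)) ⟩
  3 * ∑maps n (λ ψ → ∑[ y < 3 ] (edge-ok ψ y * h ψ y))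
    ≡⟨ cong (3 *_) (∑maps-∑-comm n (λ y ψ → edge-ok ψ y * h ψ y)) ⟩
  3 * ∑[ y < 3 ] ∑maps n (λ ψ → edge-ok ψ y * h ψ y)
    ≡⟨ cong (3 *_) (∑maps-insertAt n w (λ φ → 𝟙 (jAdj (lookup φ u) (lookup φ w)) * 𝟙-hom H φ)) ⟨
  3 * ∑maps (suc n) (λ φ → 𝟙 (jAdj (lookup φ u) (lookup φ w)) * 𝟙-hom H φ)
    ≡⟨ cong (3 *_) (jHom-addEdge H u w) ⟨
  3 * jHom (H ∪ singleEdge u w) ∎
  where
  open ≤-Reasoning
  H = removeVertex G v
  colour : Vec (Fin 3) n → Fin 3 → Fin (suc n) → Fin 3
  colour ψ y = lookup (insertAt ψ w y)
  h : Vec (Fin 3) n → Fin 3 → ℕ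
  h ψ y = 𝟙-hom H (insertAt ψ w y)
  edge-ok : Vec (Fin 3) n → Fin 3 → ℕ
  edge-ok ψ y = 𝟙 (jAdj (colour ψ y u) (colour ψ y w))
  pointwise : ∀ ψ → ∑[ y < 3 ] (jDegree (colour ψ y u) * h ψ y) ≤ 3 * ∑[ y < 3 ] (edge-ok ψ y * h ψ y)
  pointwise ψ = let x = lookup ψ u′ in begin
    ∑[ y < 3 ] (jDegree (colour ψ y u) * h ψ y)
      ≡⟨ sum-cong-≗ (λ y → cong (λ x → jDegree x * h ψ y) (insertAt-punchIn ψ w y u′)) ⟩
    ∑[ y < 3 ] (jDegree x * h ψ y)
      ≡⟨ *-distribˡ-sum (jDegree x) (h ψ) ⟨
    jDegree x * ∑[ y < 3 ] h ψ y
      ≤⟨ jDegree-weighted-≤ x (h ψ) (HomProfile-insertAt H w ψ (Simple-removeVertex v simple-G)) ⟩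
    3 * ∑[ y < 3 ] (𝟙 (jAdj x y) * h ψ y)
      ≡⟨ cong (3 *_) (sum-cong-≗ λ y → cong (λ e → 𝟙 e * h ψ y)
        (sym (cong₂ jAdj (insertAt-punchIn ψ w y u′) (insertAt-lookup ψ w y)))) ⟩
    3 * ∑[ y < 3 ] (edge-ok ψ y * h ψ y) ∎

Reducible : ∀ {n} → Graph (suc n) → Set
Reducible {n} G = ∃ λ (H : Graph n) → Simple H × edges H ≡ edges G × jHom G ≤ 3 * jHom H

reducible-isolated : ∀ {n} (G : Graph (suc n)) v → Simple G → degree G v ≡ 0 → Reducible G
reducible-isolated G v simple-G degree-v =
  removeVertex G v , Simple-removeVertex v simple-G ,
  sym (trans (edges-removeVertex G v simple-G) (cong (_+ edges (removeVertex G v)) degree-v)) ,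
  ≤-reflexive (jHom-isolated G v simple-G (degree≡0⇒isolated G v simple-G degree-v))

reducible-leaf : ∀ {n} (G : Graph (suc n)) v → Simple G → degree G v ≡ 1 → edges G < n → Reducible G
reducible-leaf {suc n} G v simple-G@(_ , loopless-G) degree-v few-edges =
  H ∪ singleEdge u w , Simple-∪ simple-H (Simple-singleEdge u w u≢w) ,
  trans (edges-addEdge H u w simple-H u≢w (proj₂ non-neighbour)) (sym edges-G) ,
  jHom-leaf-≤ G v u w simple-G (proj₁ (proj₂ neighbour)) (proj₂ (proj₂ neighbour)) u≢w
  where
  H = removeVertex G v
  simple-H = Simple-removeVertex v simple-G
  edges-G : edges G ≡ suc (edges H)
  edges-G = trans (edges-removeVertex G v simple-G) (cong (_+ edges H) degree-v)
  neighbour = ∑-𝟙≡1 (G v ∘ punchIn v) (trans (sym (degree-punchIn G v (loopless-G v))) degree-v)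
  u = proj₁ neighbour
  non-neighbour = ∃-non-neighbour H simple-H (≤-pred (subst (λ e → suc e ≤ suc n) edges-G few-edges)) u
  w = punchIn u (proj₁ non-neighbour)
  u≢w : u ≢ w
  u≢w u≡w = Fin.punchInᵢ≢i u (proj₁ non-neighbour) (sym u≡w)

reducible : ∀ {n} (G : Graph (suc n)) → Simple G → edges G < n → Reducible G
reducible {n} G simple-G few-edges with ∃-degree≤1 G simple-G (m<n⇒m<1+n few-edges)
... | v , degree≤1 with degree G v in degree-v | degree≤1
... | 0 | _ = reducible-isolated G v simple-G degree-v
... | 1 | _ = reducible-leaf G v simple-G degree-v few-edges
... | suc (suc _) | s≤s ()

-- Isolated vertices and the graphs R(n, q; m)

addIsolatedVertex : ∀ {n} → Graph n → Graph (suc n)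
addIsolatedVertex G zero    _       = false
addIsolatedVertex G (suc x) zero    = false
addIsolatedVertex G (suc x) (suc y) = G x y

Simple-addIsolatedVertex : ∀ {n} {G : Graph n} → Simple G → Simple (addIsolatedVertex G)
Simple-addIsolatedVertex {G = G} (sym-G , loopless-G) = symmetric , loopless
  where
  symmetric : ∀ x y → addIsolatedVertex G x y ≡ addIsolatedVertex G y x
  symmetric zero    zero    = refl
  symmetric zero    (suc y) = refl
  symmetric (suc x) zero    = refl
  symmetric (suc x) (suc y) = sym-G x y
  loopless : ∀ x → addIsolatedVertex G x x ≡ false
  loopless zero    = refl
  loopless (suc x) = loopless-G x

edges-addIsolatedVertex : ∀ {n} (G : Graph n) → edges (addIsolatedVertex G) ≡ edges G
edges-addIsolatedVertex {n} G = cong (_+ edges G) (trans (∑-const n 0) (*-zeroʳ n))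

jHom-addIsolatedVertex : ∀ {n} (G : Graph n) → Simple G → jHom (addIsolatedVertex G) ≡ 3 * jHom G
jHom-addIsolatedVertex G simple-G = jHom-isolated (addIsolatedVertex G) zero (Simple-addIsolatedVertex simple-G) (λ _ → refl)

≡ᵇ-refl : ∀ a → (a ≡ᵇ a) ≡ true
≡ᵇ-refl zero    = refl
≡ᵇ-refl (suc a) = ≡ᵇ-refl a

≡ᵇ-sym : ∀ a b → (a ≡ᵇ b) ≡ (b ≡ᵇ a)
≡ᵇ-sym zero    zero    = refl
≡ᵇ-sym zero    (suc b) = refl
≡ᵇ-sym (suc a) zero    = refl
≡ᵇ-sym (suc a) (suc b) = ≡ᵇ-sym a b

lexRank-sym : ∀ q a b → lexRank q a b ≡ lexRank q b a
lexRank-sym q a b = cong (λ target → length (filterᵇ (λ p → lexLt (pairVec q (proj₁ p) (proj₂ p)) target) (twoSubsets q)))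
                         (tabulate-cong λ k → ∨-comm (toℕ k ≡ᵇ a) (toℕ k ≡ᵇ b))

Simple-R : ∀ n q m → Simple (R n q m)
Simple-R n q m = symmetric , loopless
  where
  below-q : Fin n → Bool
  below-q x = toℕ x <ᵇ q
  distinct-and-early : ℕ → ℕ → Bool
  distinct-and-early a b = not (a ≡ᵇ b) ∧ (lexRank q a b <ᵇ m)
  symmetric : ∀ x y → R n q m x y ≡ R n q m y x
  symmetric x y = begin
    below-q x ∧ (below-q y ∧ distinct-and-early (toℕ x) (toℕ y))  ≡⟨ ∧-assoc (below-q x) (below-q y) _ ⟨
    (below-q x ∧ below-q y) ∧ distinct-and-early (toℕ x) (toℕ y)  ≡⟨ cong₂ _∧_ (∧-comm (below-q x) (below-q y))
                                                                       (cong₂ _∧_ (cong not (≡ᵇ-sym (toℕ x) (toℕ y)))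
                                                                                  (cong (_<ᵇ m) (lexRank-sym q (toℕ x) (toℕ y)))) ⟩
    (below-q y ∧ below-q x) ∧ distinct-and-early (toℕ y) (toℕ x)  ≡⟨ ∧-assoc (below-q y) (below-q x) _ ⟩
    below-q y ∧ (below-q x ∧ distinct-and-early (toℕ y) (toℕ x))  ∎
    where open ≡-Reasoning
  loopless : ∀ x → R n q m x x ≡ false
  loopless x rewrite ≡ᵇ-refl (toℕ x) = trans (cong (below-q x ∧_) (∧-zeroʳ (below-q x))) (∧-zeroʳ (below-q x))

≤⇒≮ᵇ : ∀ {q k} → q ≤ k → (k <ᵇ q) ≡ false
≤⇒≮ᵇ {q} {k} q≤k = ¬-not λ k<ᵇq → <⇒≱ (<ᵇ⇒< k q (subst T (sym k<ᵇq) _)) q≤k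

toℕ-punchIn-fromℕ : ∀ k (x : Fin k) → toℕ (punchIn (fromℕ k) x) ≡ toℕ x
toℕ-punchIn-fromℕ (suc k) zero    = refl
toℕ-punchIn-fromℕ (suc k) (suc x) = cong suc (toℕ-punchIn-fromℕ k x)

R-removeLast : ∀ k q m x y → removeVertex (R (suc k) q m) (fromℕ k) x y ≡ R k q m x y
R-removeLast k q m x y =
  cong₂ (λ a b → (a <ᵇ q) ∧ (b <ᵇ q) ∧ not (a ≡ᵇ b) ∧ (lexRank q a b <ᵇ m)) (toℕ-punchIn-fromℕ k x) (toℕ-punchIn-fromℕ k y)

R-last-isolated : ∀ k q m → q ≤ k → Isolated (R (suc k) q m) (fromℕ k)
R-last-isolated k q m q≤k t rewrite Fin.toℕ-fromℕ k | ≤⇒≮ᵇ q≤k = refl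

jHom-R-suc : ∀ k q m → q ≤ k → jHom (R (suc k) q m) ≡ 3 * jHom (R k q m)
jHom-R-suc k q m q≤k = trans (jHom-isolated (R (suc k) q m) (fromℕ k) (Simple-R (suc k) q m) (R-last-isolated k q m q≤k))
                             (cong (3 *_) (jHom-cong (R-removeLast k q m)))

edges-R-suc : ∀ k q m → q ≤ k → edges (R (suc k) q m) ≡ edges (R k q m)
edges-R-suc k q m q≤k = begin
  edges (R (suc k) q m)
    ≡⟨ edges-removeVertex R′ (fromℕ k) simple-R′ ⟩
  degree R′ (fromℕ k) + edges (removeVertex R′ (fromℕ k))
    ≡⟨ cong₂ _+_ (degree-isolated R′ (fromℕ k) simple-R′ (R-last-isolated k q m q≤k))
      (edges-cong (R-removeLast k q m)) ⟩
  edges (R k q m) ∎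
  where
  open ≡-Reasoning
  R′ = R (suc k) q m
  simple-R′ = Simple-R (suc k) q m

edges-R-stable : ∀ {q n} m → q ≤′ n → edges (R n q m) ≡ edges (R q q m)
edges-R-stable m (≤′-reflexive refl) = refl
edges-R-stable {q} m (≤′-step q≤′n) = trans (edges-R-suc _ q m (≤′⇒≤ q≤′n)) (edges-R-stable m q≤′n)

-- Extremality for all n ≥ q

RMaximises : ℕ → ℕ → ℕ → Set
RMaximises m q n = ∀ (G : Graph n) → Simple G → edges G ≡ m → jHom G ≤ jHom (R n q m)

RMaximises-shrink : ∀ {m q n} → q ≤ n → RMaximises m q (suc n) → RMaximises m q n
RMaximises-shrink {m} {q} {n} q≤n maximal G simple-G edges≡m = *-cancelˡ-≤ 3 (begin
  3 * jHom G                  ≡⟨ jHom-addIsolatedVertex G simple-G ⟨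
  jHom (addIsolatedVertex G)  ≤⟨ maximal (addIsolatedVertex G) (Simple-addIsolatedVertex simple-G)
                                         (trans (edges-addIsolatedVertex G) edges≡m) ⟩
  jHom (R (suc n) q m)        ≡⟨ jHom-R-suc n q m q≤n ⟩
  3 * jHom (R n q m)          ∎)
  where open ≤-Reasoning

RMaximises-grow : ∀ {m q n} → m < n → q ≤ n → RMaximises m q n → RMaximises m q (suc n)
RMaximises-grow {m} {q} {n} m<n q≤n maximal G simple-G edges≡m
  with reducible G simple-G (subst (_< n) (sym edges≡m) m<n)
... | H , simple-H , edges-H , G≤3H = begin
  jHom G               ≤⟨ G≤3H ⟩
  3 * jHom H           ≤⟨ *-monoʳ-≤ 3 (maximal H simple-H (trans edges-H edges≡m)) ⟩
  3 * jHom (R n q m)   ≡⟨ jHom-R-suc n q m q≤n ⟨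
  jHom (R (suc n) q m) ∎
  where open ≤-Reasoning

RMaximises-below : ∀ {m q n} → q ≤ n → n ≤‴ suc m → RMaximises m q (suc m) → RMaximises m q n
RMaximises-below q≤n (≤‴-reflexive refl) maximal = maximal
RMaximises-below q≤n (≤‴-step n<‴1+m) maximal = RMaximises-shrink q≤n (RMaximises-below (m≤n⇒m≤1+n q≤n) n<‴1+m maximal)

RMaximises-above : ∀ {m q n} → q ≤ suc m → suc m ≤′ n → RMaximises m q (suc m) → RMaximises m q n
RMaximises-above q≤1+m (≤′-reflexive refl) maximal = maximal
RMaximises-above q≤1+m (≤′-step 1+m≤′n) maximal =
  RMaximises-grow (≤′⇒≤ 1+m≤′n) (≤-trans q≤1+m (≤′⇒≤ 1+m≤′n)) (RMaximises-above q≤1+m 1+m≤′n maximal)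

RMaximises-everywhere : ∀ {m q n} → q ≤ suc m → q ≤ n → RMaximises m q (suc m) → RMaximises m q n
RMaximises-everywhere {m} {q} {n} q≤1+m q≤n with ≤-total n (suc m)
... | inj₁ n≤1+m = RMaximises-below q≤n (≤⇒≤‴ n≤1+m)
... | inj₂ 1+m≤n = RMaximises-above q≤1+m (≤⇒≤′ 1+m≤n)

-- Of q = ℓ(m) only q ≤ m + 1 and the extremality of R(m + 1, q; m) are used.
theorem4p2 : ∀ (m : ℕ) → 1 ≤ m → ∀ (q : ℕ) → IsEll m q →
    ∀ (n : ℕ) → q ≤ n → IsJExtremal n m (R n q m)
theorem4p2 m _ q ((_ , q≤1+m , _) , (_ , edgeCount-R₀ , R₀-extremal) , _) n q≤n =
  Simple-R n q m , edgeCount-R ,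
  λ G simple-G edgeCount-G →
    RMaximises-everywhere q≤1+m q≤n maximal G simple-G (trans (sym (edgeCount≡edges G)) edgeCount-G)
  where
  open ≡-Reasoning
  maximal : RMaximises m q (suc m)
  maximal G simple-G edges-G = R₀-extremal G simple-G (trans (edgeCount≡edges G) edges-G)
  edgeCount-R : edgeCount (R n q m) ≡ m
  edgeCount-R = begin
    edgeCount (R n q m)        ≡⟨ edgeCount≡edges (R n q m) ⟩
    edges (R n q m)            ≡⟨ edges-R-stable m (≤⇒≤′ q≤n) ⟩
    edges (R q q m)            ≡⟨ edges-R-stable m (≤⇒≤′ q≤1+m) ⟨
    edges (R (suc m) q m)      ≡⟨ edgeCount≡edges (R (suc m) q m) ⟨
    edgeCount (R (suc m) q m)  ≡⟨ edgeCount-R₀ ⟩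
    m                          ∎
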